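{- Let $w$ be a word on the alphabet $\{1,2,3,\dots\}$ avoiding the patterns $aba$ and $acb$. Then $w$ is uniquely determined by the two words $\mathrm{NInc}(w)$ and $\mathrm{Low}(w)$: if $w'$ is another word avoiding $aba$ and $acb$ with $\mathrm{NInc}(w')=\mathrm{NInc}(w)$ and $\mathrm{Low}(w')=\mathrm{Low}(w)$, then $w'=w$.
   Context: For a word $w=w_1\cdots w_n$, $\mathrm{NInc}(w)$ is the word obtained by rearranging its letters in nonincreasing order, and $\mathrm{Low}(w)$ is the unique nonincreasing word of length $n$ having the same left-to-right minima as $w$ at the same positions (equivalently, $\mathrm{Low}(w)_i=\min(w_1,\dots,w_i)$). A word $w$ avoids the patterns $aba$ and $acb$ if there are no indices $i<j<k$ with $w_i=w_k<w_j$ or $w_i<w_k<w_j$. -}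

module Defs where

open import Data.Nat using (ℕ; zero; suc; _≤_; _<_; _≤ᵇ_; _⊓_)
open import Data.Bool using (if_then_else_)
open import Data.List using (List; []; _∷_; length; lookup)
open import Data.List.Relation.Unary.All using (All)
open import Data.Fin using (Fin) renaming (_<_ to _<ᶠ_)
open import Data.Product using (∃-syntax; _×_)
open import Relation.Nullary using (¬_)
open import Relation.Binary.PropositionalEquality using (_≡_)

Word : Set
Word = List ℕ

PositiveWord : Word → Set
PositiveWord w = All (1 ≤_) w

ContainsABA : Word → Set
ContainsABA w = ∃[ i ] ∃[ j ] ∃[ k ]
  (i <ᶠ j × j <ᶠ k × lookup w i ≡ lookup w k × lookup w k < lookup w j)

ContainsACB : Word → Set
ContainsACB w = ∃[ i ] ∃[ j ] ∃[ k ]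
  (i <ᶠ j × j <ᶠ k × lookup w i < lookup w k × lookup w k < lookup w j)

AvoidsABAandACB : Word → Set
AvoidsABAandACB w = ¬ ContainsABA w × ¬ ContainsACB w

insertDesc : ℕ → List ℕ → List ℕ
insertDesc x [] = x ∷ []
insertDesc x (y ∷ ys) = if y ≤ᵇ x then x ∷ y ∷ ys else y ∷ insertDesc x ys

NInc : Word → Word
NInc [] = []
NInc (x ∷ xs) = insertDesc x (NInc xs)

lowFrom : ℕ → Word → Word
lowFrom m [] = []
lowFrom m (x ∷ xs) = (m ⊓ x) ∷ lowFrom (m ⊓ x) xs

Low : Word → Word
Low [] = []
Low (x ∷ xs) = x ∷ lowFrom x xs

-- The patterns aba and acb together say w_i ≤ w_k < w_j for some i < j < k.
-- Read two such words with the same multiset of letters and the same prefix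
-- minima from the left.  At the first position where they differ, say with
-- letters x < y, equality of the prefix minima forces the current minimum m
-- to be ≤ x, and x must still occur after y in the word holding y; then
-- m, y, x is an occurrence of m ≤ x < y.
module Submission where

open import Defs
open import Data.Nat using (ℕ; _≤_; _<_; _≤ᵇ_; _⊓_; z<s; s<s)
open import Data.Nat.Properties
  using (<-cmp; <-irrefl; ≤-total; ≤-reflexive; ⊓-sel; m≤n⇒m<n∨m≡n; m≥n⇒m⊓n≡n)
open import Data.Fin using (Fin; zero; suc) renaming (_<_ to _<ᶠ_)
open import Data.List using (List; []; _∷_; length; lookup)
open import Data.List.Properties using (∷-injective)
open import Data.List.Membership.Propositional using (_∈_)
open import Data.List.Relation.Unary.Any using (here; there)
open import Data.List.Relation.Binary.Sublist.Propositional
  using (_⊆_; _∷_; _∷ʳ_; ⊆-refl; ⊆-trans; from∈)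
open import Data.List.Relation.Binary.Permutation.Propositional
  using (_↭_; ↭-refl; ↭-sym; ↭-trans; ↭-reflexive; prep; swap)
open import Data.List.Relation.Binary.Permutation.Propositional.Properties
  using (∈-resp-↭; drop-∷)
open import Data.Bool using (true; false)
open import Data.Product using (_,_)
open import Data.Sum using (_⊎_; inj₁; inj₂; [_,_])
open import Data.Empty using (⊥-elim)
open import Relation.Nullary using (¬_)
open import Relation.Binary.Definitions using (tri<; tri≈; tri>)
open import Relation.Binary.PropositionalEquality
  using (_≡_; refl; sym; trans; cong; subst₂)

private
  variable
    a b c m x y : ℕ
    t s w : Word

insertDesc-↭ : ∀ x l → insertDesc x l ↭ x ∷ l
insertDesc-↭ x [] = ↭-refl
insertDesc-↭ x (y ∷ l) with y ≤ᵇ x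
... | true  = ↭-refl
... | false = ↭-trans (prep y (insertDesc-↭ x l)) (swap y x ↭-refl)

NInc-↭ : ∀ w → NInc w ↭ w
NInc-↭ []      = ↭-refl
NInc-↭ (x ∷ w) = ↭-trans (insertDesc-↭ x (NInc w)) (prep x (NInc-↭ w))

NInc-≡⇒↭ : ∀ {w w′} → NInc w′ ≡ NInc w → w′ ↭ w
NInc-≡⇒↭ {w} {w′} eq =
  ↭-trans (↭-sym (NInc-↭ w′)) (↭-trans (↭-reflexive eq) (NInc-↭ w))

⊆-index : ∀ {A : Set} {xs ys : List A} → xs ⊆ ys → Fin (length xs) → Fin (length ys)
⊆-index (y ∷ʳ τ) i       = suc (⊆-index τ i)
⊆-index (_ ∷ τ)  zero    = zero
⊆-index (_ ∷ τ)  (suc i) = suc (⊆-index τ i)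

lookup-⊆-index : ∀ {A : Set} {xs ys : List A} (τ : xs ⊆ ys) i → lookup ys (⊆-index τ i) ≡ lookup xs i
lookup-⊆-index (y ∷ʳ τ)   i       = lookup-⊆-index τ i
lookup-⊆-index (refl ∷ τ) zero    = refl
lookup-⊆-index (_ ∷ τ)    (suc i) = lookup-⊆-index τ i

⊆-index-mono : ∀ {A : Set} {xs ys : List A} (τ : xs ⊆ ys) {i j} → i <ᶠ j → ⊆-index τ i <ᶠ ⊆-index τ j
⊆-index-mono (y ∷ʳ τ) i<j                       = s<s (⊆-index-mono τ i<j)
⊆-index-mono (_ ∷ τ)  {zero}  {suc j} _         = z<s
⊆-index-mono (_ ∷ τ)  {suc i} {suc j} (s<s i<j) = s<s (⊆-index-mono τ i<j)

≤<-pattern⇒ABA⊎ACB : a ≤ c → c < b → a ∷ b ∷ c ∷ [] ⊆ w → ContainsABA w ⊎ ContainsACB w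
≤<-pattern⇒ABA⊎ACB {a = a} {c = c} {w = w} a≤c c<b τ =
  [ (λ a<c → inj₂ (i , j , k , i<j , j<k , subst₂ _<_ (sym wᵢ≡a) (sym wₖ≡c) a<c , wₖ<wⱼ))
  , (λ a≡c → inj₁ (i , j , k , i<j , j<k , trans wᵢ≡a (trans a≡c (sym wₖ≡c)) , wₖ<wⱼ))
  ] (m≤n⇒m<n∨m≡n a≤c)
  where
  i j k : Fin (length w)
  i = ⊆-index τ zero
  j = ⊆-index τ (suc zero)
  k = ⊆-index τ (suc (suc zero))
  i<j : i <ᶠ j
  i<j = ⊆-index-mono τ z<s
  j<k : j <ᶠ k
  j<k = ⊆-index-mono τ (s<s z<s)
  wᵢ≡a : lookup w i ≡ a
  wᵢ≡a = lookup-⊆-index τ zero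
  wₖ≡c : lookup w k ≡ c
  wₖ≡c = lookup-⊆-index τ (suc (suc zero))
  wₖ<wⱼ : lookup w k < lookup w j
  wₖ<wⱼ = subst₂ _<_ (sym wₖ≡c) (sym (lookup-⊆-index τ (suc zero))) c<b

Avoids≤< : Word → Set
Avoids≤< w = ∀ {a b c} → a ≤ c → c < b → ¬ (a ∷ b ∷ c ∷ [] ⊆ w)

avoidsABAandACB⇒Avoids≤< : AvoidsABAandACB w → Avoids≤< w
avoidsABAandACB⇒Avoids≤< (noABA , noACB) a≤c c<b τ =
  [ noABA , noACB ] (≤<-pattern⇒ABA⊎ACB a≤c c<b τ)

Avoids≤<-⊆ : ∀ {xs ys} → xs ⊆ ys → Avoids≤< ys → Avoids≤< xs
Avoids≤<-⊆ σ av a≤c c<b τ = av a≤c c<b (⊆-trans τ σ)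

⊓∷⊆ : ∀ m x t → m ⊓ x ∷ t ⊆ m ∷ x ∷ t
⊓∷⊆ m x t with ⊓-sel m x
... | inj₁ m⊓x≡m = m⊓x≡m ∷ (x ∷ʳ ⊆-refl)
... | inj₂ m⊓x≡x = m ∷ʳ (m⊓x≡x ∷ ⊆-refl)

m⊓n≡m⊓o∧n<o⇒m≤n : ∀ m {n o} → m ⊓ n ≡ m ⊓ o → n < o → m ≤ n
m⊓n≡m⊓o∧n<o⇒m≤n m {n} {o} eq n<o with ≤-total m n
... | inj₁ m≤n = m≤n
... | inj₂ n≤m =
  [ (λ m⊓o≡m → ≤-reflexive (sym (trans n≡m⊓o m⊓o≡m)))
  , (λ m⊓o≡o → ⊥-elim (<-irrefl (trans n≡m⊓o m⊓o≡o) n<o))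
  ] (⊓-sel m o)
  where
  n≡m⊓o : n ≡ m ⊓ o
  n≡m⊓o = trans (sym (m≥n⇒m⊓n≡n n≤m)) eq

first-difference⇒pattern : m ≤ x → x < y → x ∷ t ↭ y ∷ s → ¬ Avoids≤< (m ∷ y ∷ s)
first-difference⇒pattern m≤x x<y p av with ∈-resp-↭ p (here refl)
... | here x≡y  = <-irrefl x≡y x<y
... | there x∈s = av m≤x x<y (refl ∷ refl ∷ from∈ x∈s)

-- m stands for the prefix read so far (only its minimum matters), so
-- Avoids≤< (m ∷ u) is the part of the avoidance of the whole word still needed.
lowFrom-↭-injective : ∀ m {u u′} → Avoids≤< (m ∷ u) → Avoids≤< (m ∷ u′) →
                      u′ ↭ u → lowFrom m u′ ≡ lowFrom m u → u′ ≡ u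
lowFrom-↭-injective m {[]}    {[]}    _  _   _ _  = refl
lowFrom-↭-injective m {[]}    {_ ∷ _} _  _   _ ()
lowFrom-↭-injective m {_ ∷ _} {[]}    _  _   _ ()
lowFrom-↭-injective m {x ∷ t} {y ∷ s} av av′ p eq with ∷-injective eq | <-cmp y x
... | _ , tails | tri≈ _ refl _ =
  cong (y ∷_) (lowFrom-↭-injective (m ⊓ y) (Avoids≤<-⊆ (⊓∷⊆ m y t) av)
                 (Avoids≤<-⊆ (⊓∷⊆ m y s) av′) (drop-∷ p) tails)
... | heads , _ | tri< y<x _ _ =
  ⊥-elim (first-difference⇒pattern (m⊓n≡m⊓o∧n<o⇒m≤n m heads y<x) y<x p av)
... | heads , _ | tri> _ _ x<y =
  ⊥-elim (first-difference⇒pattern (m⊓n≡m⊓o∧n<o⇒m≤n m (sym heads) x<y) x<y (↭-sym p) av′)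

lemma3p1 : (w w′ : Word) → PositiveWord w → PositiveWord w′
    → AvoidsABAandACB w → AvoidsABAandACB w′
    → NInc w′ ≡ NInc w → Low w′ ≡ Low w → w′ ≡ w
lemma3p1 []      []      _ _ _  _   _    _  = refl
lemma3p1 []      (_ ∷ _) _ _ _  _   _    ()
lemma3p1 (_ ∷ _) []      _ _ _  _   _    ()
lemma3p1 (x ∷ t) (y ∷ s) _ _ av av′ nInc low with ∷-injective low
... | refl , lows =
  cong (x ∷_) (lowFrom-↭-injective x (avoidsABAandACB⇒Avoids≤< av)
                 (avoidsABAandACB⇒Avoids≤< av′) (drop-∷ (NInc-≡⇒↭ nInc)) lows)
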